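{- For $L\cdot K$ sufficiently large, if $(x,y)$ is drawn from $\mu$, then with probability at least $95\%$ Bob's input $y$ is evenly-spreading.
   Context: Multi-index inputs with parameters $L,K,p$: $x\in\mathbb{F}_p^{LK}$; $y=(y_1,\dots,y_L)$ with each $y_i\in\{0,1\}^{LK}\subseteq\mathbb{F}_p^{LK}$ having at most one $1$ in each of the $K$ consecutive blocks of $L$ coordinates. The distribution $\mu$: let $B=2^b$, $K$, $p$ be such that for some binary string $s$ of length $<b$, $L=B/2^{|s|+1}$. Consider batch partial sum ($K$ sequences $A_{i,j}$, $i\in[K]$, $j\in[B]$, over $\mathbb{F}_p$; update$(\mathbf{j},\mathbf{v})$ sets $A_{i,j_i}:=v_i$; query$(\mathbf{j})$ returns $\sum_i\sum_{l\le j_i}A_{i,l}$) and the random sequence $U_0,Q_0,\dots,U_{B-1},Q_{B-1}$ where, identifying $t$ with a $b$-bit string and a $b$-bit string $x$ with position $x+1\in[B]$, $U_t$ = update$(\mathbf{j},\mathbf{v})$ with $j_i=\mathrm{rev}(t)$ (bits reversed) for all $i$ and $v_i$ independent uniform in $\mathbb{F}_p$, and $Q_t$ = query$(\mathbf{j})$ with $j_i$ independent uniform in $[B]$. Let $I_A$ (resp. $I_B$) be the operations $U_t,Q_t$ with $s0$ (resp. $s1$) a prefix of $t$. For $k\in[K]$ let $\mathcal{E}_k$ be the set of the $L$ entries of sequence $k$ updated in $I_A$. The $l$-th coordinate of block $k$ of $x$ is the sum of the values written to the $l$ smallest-indexed entries of $\mathcal{E}_k$. For the $i$-th query of $I_B$,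 query$(j_{i,1},\dots,j_{i,K})$, and each $k$, let $l$ be the number of entries of $\mathcal{E}_k$ with index $\le j_{i,k}$; block $k$ of $y_i$ is zero if $l=0$ and otherwise has a single $1$ in coordinate $l$. $\mu$ is the distribution of $(x,y)$. Evenly-spreading: $y$ is evenly-spreading if for every set $S$ of at most $0.1LK$ coordinates, the total number of ones of $y_1,\dots,y_L$ located in coordinates of $S$ is at most $0.9LK$. -}

module Defs where

open import Data.Nat using (ℕ; zero; suc; _+_; _*_; _^_; _≤_; _%_; _/_; _≡ᵇ_)
open import Data.Nat.Properties using (_≤?_)
open import Data.Fin using (Fin; toℕ; combine) renaming (zero to fz; suc to fs)
open import Data.Bool using (Bool; true; false; if_then_else_; T)
open import Data.List using (List; length; filter; upTo)
open import Data.Vec.Functional using (_∷_)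
open import Data.Product using (Σ; _×_; _,_; proj₁; proj₂)

∑ : (n : ℕ) → (Fin n → ℕ) → ℕ
∑ zero    f = 0
∑ (suc n) f = f fz + ∑ n (λ i → f (fs i))

-- A "summer" for a finite type A: sums an ℕ-valued function over all of A.
Summer : Set → Set
Summer A = (A → ℕ) → ℕ

sumFun : {A : Set} (n : ℕ) → Summer A → Summer (Fin n → A)
sumFun zero    σ F = F (λ ())
sumFun (suc n) σ F = σ (λ a → sumFun n σ (λ f → F (a ∷ f)))

-- Uniform probability on a finite sample space (given by its summer):
-- Pr[E] ≥ num/den, witnessed by a Boolean-valued subevent G ⊆ E with
-- den · #G ≥ num · #Ω.

ProbAtLeast : {Ω : Set} → Summer Ω → (Ω → Set) → ℕ → ℕ → Set
ProbAtLeast {Ω} σ E num den =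
  Σ (Ω → Bool) λ G →
    ((ω : Ω) → T (G ω) → E ω) ×
    (num * σ (λ _ → 1) ≤ den * σ (λ ω → if G ω then 1 else 0))

-- Bob's inputs and the evenly-spreading property
-- y = (y_1..y_L), y_i ∈ {0,1}^{LK}; coordinate (k , l) = l-th coordinate
-- of block k (l 0-based here).

BobInput : ℕ → ℕ → Set
BobInput L K = Fin L → Fin K → Fin L → ℕ

size : (L K : ℕ) → (Fin K → Fin L → Bool) → ℕ
size L K S = ∑ K (λ k → ∑ L (λ l → if S k l then 1 else 0))

onesIn : (L K : ℕ) → BobInput L K → (Fin K → Fin L → Bool) → ℕ
onesIn L K y S = ∑ L (λ i → ∑ K (λ k → ∑ L (λ l → if S k l then y i k l else 0)))

EvenlySpreading : (L K : ℕ) → BobInput L K → Set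
EvenlySpreading L K y =
  (S : Fin K → Fin L → Bool) →
  10 * size L K S ≤ L * K →
  10 * onesIn L K y S ≤ 9 * (L * K)

-- Parameters: a = |s|, c with L = 2^c, b = a + 1 + c, B = 2^b
-- (written as (2^a * 2) * 2^c so that times t decompose as (s, bit, r)),
-- s : Fin (2^a) is the a-bit string s (as a number, MSB first).
-- Positions x+1 ∈ [B] are represented 0-based by x.

revBits : ℕ → ℕ → ℕ
revBits zero    t = 0
revBits (suc b) t = (t % 2) * 2 ^ b + revBits b (t / 2)

Bsz : ℕ → ℕ → ℕ
Bsz a c = (2 ^ a * 2) * 2 ^ c

-- the time t = s·bit·r (binary concatenation)
time : (a c : ℕ) → Fin (2 ^ a) → Fin 2 → Fin (2 ^ c) → Fin (Bsz a c)
time a c s bit r = combine (combine s bit) r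

-- l = #{ e ∈ E_k : e ≤ j }, where E_k = { rev(t) : t has prefix s0 }
-- (the same set for every k)
countE : (a c : ℕ) → Fin (2 ^ a) → ℕ → ℕ
countE a c s j =
  length (filter (λ r → revBits (a + suc c) ((toℕ s * 2) * 2 ^ c + r) ≤? j)
                 (upTo (2 ^ c)))

-- Sample space: update values V t k ∈ F_p and query indices Q t k ∈ [B]
Sample : (a c K p : ℕ) → Set
Sample a c K p = (Fin (Bsz a c) → Fin K → Fin p) × (Fin (Bsz a c) → Fin K → Fin (Bsz a c))

sumSample : (a c K p : ℕ) → Summer (Sample a c K p)
sumSample a c K p F =
  sumFun (Bsz a c) (sumFun K (∑ p)) (λ V →
    sumFun (Bsz a c) (sumFun K (∑ (Bsz a c))) (λ Q → F (V , Q)))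

-- Bob's input: y_i from the i-th query of I_B (time s1i);
-- block k of y_i has a single 1 in coordinate l (1-based) iff l = countE ≥ 1.
bobInput : (a c K p : ℕ) → Fin (2 ^ a) → Sample a c K p → BobInput (2 ^ c) K
bobInput a c K p s ω i k l =
  if suc (toℕ l) ≡ᵇ countE a c s (toℕ (proj₂ ω (time a c s (fs fz) i) k))
  then 1 else 0

-- Let n(k,l) be the number of queries of I_B whose k-th index falls into coordinate l, and
-- Z = Σ C(n(k,l), 5). As n ≤ 5 + C(n, 5), a set S of coordinates carries at most 5|S| + Z
-- ones, so y is evenly spreading once Z ≤ 0.4 LK. Each n(k,l) is a sum of L independent
-- indicators of probability w(l)/B, where w(l) ≤ W = B/L because the entries updated in I_A
-- are W apart, and Σ w(l) ≤ B. The binomial moment E C(n,5) = C(L,5) (w/B)^5 ≤ (Lw/B)^5/120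
-- then gives E Z ≤ LK/120, and by Markov Z > 0.4 LK has probability at most 1/48 < 5%.

module Submission where

open import Defs
open import Data.Nat using (ℕ; _≤_; _*_; _^_)
open import Data.Nat.Primality using (Prime)
open import Data.Fin using (Fin)
open import Data.Product using (Σ)

open import Data.Bool using (Bool; true; false; not; T; if_then_else_)
open import Data.Empty using (⊥-elim)
open import Data.Fin using (toℕ; combine; remQuot) renaming (zero to fz; suc to fs)
open import Data.Fin.Properties using (toℕ<n; toℕ-injective; remQuot-combine)
  renaming (suc-injective to fs-injective)
open import Data.List as List using (length; filter; upTo)
open import Data.List.Membership.Propositional using (lose)
open import Data.List.Membership.Propositional.Properties using (∈-upTo⁺)
open import Data.List.Relation.Unary.Any using (Any; here; there)
open import Data.Nat
open import Data.Nat.Combinatorics using (_C_; nCk+nC[k+1]≡[n+1]C[k+1]; nC1≡n)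
open import Data.Nat.DivMod
open import Data.Nat.Divisibility using (divides)
open import Data.Nat.Properties
open import Algebra.Properties.CommutativeSemigroup +-commutativeSemigroup
  using () renaming (interchange to +-interchange)
open import Algebra.Properties.CommutativeSemigroup *-commutativeSemigroup using (x∙yz≈y∙xz)
open import Data.Nat.Tactic.RingSolver using (solve-∀)
open import Data.Product using (_×_; _,_; proj₁; proj₂)
open import Data.Vec.Functional using (_∷_)
open import Function using (_∘_)
open import Relation.Binary.Definitions using (tri<; tri≈; tri>)
open import Relation.Binary.PropositionalEquality
open import Relation.Nullary using (¬_; yes; no; contradiction)
open import Relation.Unary using (Decidable)

𝟙 : Bool → ℕ
𝟙 b = if b then 1 else 0

record Linear {A : Set} (σ : Summer A) : Set where
  field
    ext    : ∀ {f g : A → ℕ} → (∀ a → f a ≡ g a) → σ f ≡ σ g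
    0-homo : σ (λ _ → 0) ≡ 0
    +-homo : ∀ f g → σ (λ a → f a + g a) ≡ σ f + σ g

  *-homo : ∀ c f → σ (λ a → c * f a) ≡ c * σ f
  *-homo zero    f = 0-homo
  *-homo (suc c) f = trans (+-homo f (λ a → c * f a)) (cong (σ f +_) (*-homo c f))

  const : ∀ c → σ (λ _ → c) ≡ c * σ (λ _ → 1)
  const c = trans (ext (λ _ → sym (*-identityʳ c))) (*-homo c (λ _ → 1))

  mono : ∀ {f g : A → ℕ} → (∀ a → f a ≤ g a) → σ f ≤ σ g
  mono {f} {g} f≤g = begin
    σ f                          ≤⟨ m≤m+n (σ f) _ ⟩
    σ f + σ (λ a → g a ∸ f a)    ≡⟨ +-homo f _ ⟨
    σ (λ a → f a + (g a ∸ f a))  ≡⟨ ext (λ a → m+[n∸m]≡n (f≤g a)) ⟩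
    σ g                          ∎
    where open ≤-Reasoning

∑-linear : ∀ n → Linear (∑ n)
∑-linear n = record { ext = ext n ; 0-homo = 0-homo n ; +-homo = +-homo n }
  where
  ext : ∀ n {f g : Fin n → ℕ} → (∀ i → f i ≡ g i) → ∑ n f ≡ ∑ n g
  ext zero    f≡g = refl
  ext (suc n) f≡g = cong₂ _+_ (f≡g fz) (ext n (f≡g ∘ fs))

  0-homo : ∀ n → ∑ n (λ _ → 0) ≡ 0
  0-homo zero    = refl
  0-homo (suc n) = 0-homo n

  +-homo : ∀ n f g → ∑ n (λ i → f i + g i) ≡ ∑ n f + ∑ n g
  +-homo zero    f g = refl
  +-homo (suc n) f g =
    trans (cong (f fz + g fz +_) (+-homo n (f ∘ fs) (g ∘ fs)))
          (+-interchange (f fz) (g fz) _ _)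

∑-1 : ∀ n → ∑ n (λ _ → 1) ≡ n
∑-1 zero    = refl
∑-1 (suc n) = cong suc (∑-1 n)

∑-const : ∀ n c → ∑ n (λ _ → c) ≡ n * c
∑-const n c = trans (Linear.const (∑-linear n) c) (trans (cong (c *_) (∑-1 n)) (*-comm c n))

∑-swap : ∀ n {C : Set} {τ : Summer C} → Linear τ → (F : Fin n → C → ℕ) →
         ∑ n (λ i → τ (F i)) ≡ τ (λ c → ∑ n (λ i → F i c))
∑-swap zero    τ-linear F = sym (Linear.0-homo τ-linear)
∑-swap (suc n) {τ = τ} τ-linear F =
  trans (cong (τ (F fz) +_) (∑-swap n τ-linear (F ∘ fs))) (sym (Linear.+-homo τ-linear (F fz) _))

∑-𝟙-unique : ∀ n (b : Fin n → Bool) → (∀ i j → T (b i) → T (b j) → i ≡ j) →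
             ∑ n (λ i → 𝟙 (b i)) ≤ 1
∑-𝟙-unique zero    b unique = z≤n
∑-𝟙-unique (suc n) b unique with b fz in b₀
... | false = ∑-𝟙-unique n (b ∘ fs) (λ i j bi bj → fs-injective (unique (fs i) (fs j) bi bj))
... | true  = ≤-reflexive (cong suc (trans (Linear.ext (∑-linear n) rest-false) (Linear.0-homo (∑-linear n))))
  where
  rest-false : ∀ i → 𝟙 (b (fs i)) ≡ 0
  rest-false i with b (fs i) in bᵢ
  ... | false = refl
  ... | true  with () ← unique (fs i) fz (subst T (sym bᵢ) _) (subst T (sym b₀) _)

∑-level-sets≤ : ∀ L B (g : Fin B → ℕ) → ∑ L (λ l → ∑ B (λ x → 𝟙 (suc (toℕ l) ≡ᵇ g x))) ≤ B
∑-level-sets≤ L B g = begin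
  ∑ L (λ l → ∑ B (λ x → 𝟙 (suc (toℕ l) ≡ᵇ g x)))  ≡⟨ ∑-swap L (∑-linear B) _ ⟩
  ∑ B (λ x → ∑ L (λ l → 𝟙 (suc (toℕ l) ≡ᵇ g x)))  ≤⟨ Linear.mono (∑-linear B) at-most-one ⟩
  ∑ B (λ _ → 1)                                   ≡⟨ ∑-1 B ⟩
  B                                               ∎
  where
  open ≤-Reasoning
  at-most-one : ∀ x → ∑ L (λ l → 𝟙 (suc (toℕ l) ≡ᵇ g x)) ≤ 1
  at-most-one x = ∑-𝟙-unique L _ λ l l′ hit-l hit-l′ →
    toℕ-injective (suc-injective (trans (≡ᵇ⇒≡ (suc (toℕ l)) (g x) hit-l)
                                        (sym (≡ᵇ⇒≡ (suc (toℕ l′)) (g x) hit-l′))))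

∑-toℕ-+ : ∀ m n (g : ℕ → ℕ) → ∑ (m + n) (g ∘ toℕ) ≡ ∑ m (g ∘ toℕ) + ∑ n (λ j → g (m + toℕ j))
∑-toℕ-+ zero    n g = refl
∑-toℕ-+ (suc m) n g = trans (cong (g 0 +_) (∑-toℕ-+ m n (g ∘ suc))) (sym (+-assoc (g 0) _ _))

∑-toℕ-* : ∀ m n (g : ℕ → ℕ) → ∑ (m * n) (g ∘ toℕ) ≡ ∑ m (λ i → ∑ n (λ j → g (toℕ i * n + toℕ j)))
∑-toℕ-* zero    n g = refl
∑-toℕ-* (suc m) n g =
  trans (∑-toℕ-+ n (m * n) g)
        (cong (∑ n (g ∘ toℕ) +_)
              (trans (∑-toℕ-* m n (λ x → g (n + x)))
                     (Linear.ext (∑-linear m) (λ i → Linear.ext (∑-linear n) (λ j →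
                       cong g (sym (+-assoc n (toℕ i * n) (toℕ j))))))))

sumFun-linear : ∀ {A : Set} {σ : Summer A} n → Linear σ → Linear (sumFun n σ)
sumFun-linear {σ = σ} n σ-linear =
  record { ext = ext n ; 0-homo = 0-homo n ; +-homo = +-homo n }
  where
  open Linear σ-linear using () renaming (ext to σ-ext; 0-homo to σ-0; +-homo to σ-+)

  ext : ∀ n {f g : (Fin n → _) → ℕ} → (∀ a → f a ≡ g a) → sumFun n σ f ≡ sumFun n σ g
  ext zero    f≡g = f≡g _
  ext (suc n) f≡g = σ-ext (λ a → ext n (λ h → f≡g (a ∷ h)))

  0-homo : ∀ n → sumFun n σ (λ _ → 0) ≡ 0
  0-homo zero    = refl
  0-homo (suc n) = trans (σ-ext (λ _ → 0-homo n)) σ-0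

  +-homo : ∀ n f g → sumFun n σ (λ a → f a + g a) ≡ sumFun n σ f + sumFun n σ g
  +-homo zero    f g = refl
  +-homo (suc n) f g =
    trans (σ-ext (λ a → +-homo n (λ h → f (a ∷ h)) (λ h → g (a ∷ h)))) (σ-+ _ _)

_⊗_ : {A C : Set} → Summer A → Summer C → Summer (A × C)
(σ ⊗ τ) F = σ (λ a → τ (λ c → F (a , c)))

⊗-linear : {A C : Set} {σ : Summer A} {τ : Summer C} →
           Linear σ → Linear τ → Linear (σ ⊗ τ)
⊗-linear σ-linear τ-linear = record
  { ext    = λ f≡g → σ-ext (λ a → τ-ext (λ c → f≡g (a , c)))
  ; 0-homo = trans (σ-ext (λ _ → τ-0)) σ-0
  ; +-homo = λ f g → trans (σ-ext (λ a → τ-+ _ _)) (σ-+ _ _)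
  }
  where
  open Linear σ-linear using () renaming (ext to σ-ext; 0-homo to σ-0; +-homo to σ-+)
  open Linear τ-linear using () renaming (ext to τ-ext; 0-homo to τ-0; +-homo to τ-+)

∑⊗∑-swap : ∀ K L {C : Set} {τ : Summer C} → Linear τ → (F : Fin K × Fin L → C → ℕ) →
           (∑ K ⊗ ∑ L) (λ kl → τ (F kl)) ≡ τ (λ x → (∑ K ⊗ ∑ L) (λ kl → F kl x))
∑⊗∑-swap K L τ-linear F =
  trans (Linear.ext (∑-linear K) (λ k → ∑-swap L τ-linear (λ l → F (k , l)))) (∑-swap K τ-linear _)

_[_]≔_ : {A : Set} {n : ℕ} → (Fin n → A) → Fin n → A → (Fin n → A)
_[_]≔_ {n = suc n} f fz     x = x ∷ (f ∘ fs)
_[_]≔_ {n = suc n} f (fs t) x = f fz ∷ ((f ∘ fs) [ t ]≔ x)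

[]≔-updates : ∀ {A : Set} {n} (f : Fin n → A) t x → (f [ t ]≔ x) t ≡ x
[]≔-updates f fz     x = refl
[]≔-updates f (fs t) x = []≔-updates (f ∘ fs) t x

[]≔-minimal : ∀ {A : Set} {n} (f : Fin n → A) t x {t′} → t′ ≢ t → (f [ t ]≔ x) t′ ≡ f t′
[]≔-minimal f fz     x {fz}    t′≢t = ⊥-elim (t′≢t refl)
[]≔-minimal f fz     x {fs t′} t′≢t = refl
[]≔-minimal f (fs t) x {fz}    t′≢t = refl
[]≔-minimal f (fs t) x {fs t′} t′≢t = []≔-minimal (f ∘ fs) t x (t′≢t ∘ cong fs)

-- Resampling the state a to R a x with x uniform in Fin B does not change its distribution.
Resamples : {A : Set} (B : ℕ) → Summer A → (A → Fin B → A) → Set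
Resamples B σ R = ∀ G → B * σ G ≡ σ (λ a → ∑ B (λ x → G (R a x)))

∑-resamples : ∀ B → Resamples B (∑ B) (λ _ x → x)
∑-resamples B G = sym (∑-const B (∑ B G))

sumFun-resamples : ∀ {A : Set} {σ : Summer A} {B} {R : A → Fin B → A} →
  Linear σ → Resamples B σ R →
  ∀ n (t : Fin n) → Resamples B (sumFun n σ) (λ f x → f [ t ]≔ R (f t) x)
sumFun-resamples {σ = σ} {B} {R} σ-linear σ-resamples (suc n) fz G = begin
  B * σ (λ a → sumFun n σ (λ f → G (a ∷ f)))
    ≡⟨ σ-resamples _ ⟩
  σ (λ a → ∑ B (λ x → sumFun n σ (λ f → G (R a x ∷ f))))
    ≡⟨ Linear.ext σ-linear (λ a → ∑-swap B (sumFun-linear n σ-linear) _) ⟩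
  σ (λ a → sumFun n σ (λ f → ∑ B (λ x → G (R a x ∷ f))))
    ∎
  where open ≡-Reasoning
sumFun-resamples {σ = σ} {B} {R} σ-linear σ-resamples (suc n) (fs t) G =
  trans (sym (Linear.*-homo σ-linear B _))
        (Linear.ext σ-linear (λ a → sumFun-resamples {R = R} σ-linear σ-resamples n t (λ f → G (a ∷ f))))

⊗-resamples : ∀ {A C : Set} {σ : Summer A} {τ : Summer C} {B} {R : C → Fin B → C} →
  Linear σ → Resamples B τ R → Resamples B (σ ⊗ τ) (λ ac x → proj₁ ac , R (proj₂ ac) x)
⊗-resamples {B = B} σ-linear τ-resamples G =
  trans (sym (Linear.*-homo σ-linear B _))
        (Linear.ext σ-linear (λ a → τ-resamples (λ c → G (a , c))))

C-𝟙+ : ∀ b n r → (𝟙 b + n) C suc r ≡ n C suc r + 𝟙 b * (n C r)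
C-𝟙+ true  n r = begin
  suc n C suc r              ≡⟨ nCk+nC[k+1]≡[n+1]C[k+1] n r ⟨
  n C r + n C suc r          ≡⟨ +-comm (n C r) _ ⟩
  n C suc r + n C r          ≡⟨ cong (n C suc r +_) (*-identityˡ (n C r)) ⟨
  n C suc r + 1 * (n C r)    ∎
  where open ≡-Reasoning
C-𝟙+ false n r = sym (+-identityʳ _)

-- m events, each of probability |h| / B and independent of the others: event i is
-- decided by a coordinate of the state that resample i redraws uniformly from Fin B.
record IndependentTrials {Ω : Set} (σ : Summer Ω) (B : ℕ) (h : Fin B → Bool) (m : ℕ) : Set where
  field
    event           : Fin m → Ω → Bool
    resample        : Fin m → Ω → Fin B → Ω
    resamples       : ∀ i → Resamples B σ (resample i)
    event-resampled : ∀ i ω x → event i (resample i ω x) ≡ h x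
    event-untouched : ∀ i j → j ≢ i → ∀ ω x → event j (resample i ω x) ≡ event j ω

  successes : Ω → ℕ
  successes ω = ∑ m (λ i → 𝟙 (event i ω))

tail : ∀ {Ω : Set} {σ : Summer Ω} {B h m} →
       IndependentTrials σ B h (suc m) → IndependentTrials σ B h m
tail T = record
  { event           = event ∘ fs
  ; resample        = resample ∘ fs
  ; resamples       = resamples ∘ fs
  ; event-resampled = event-resampled ∘ fs
  ; event-untouched = λ i j j≢i → event-untouched (fs i) (fs j) (j≢i ∘ fs-injective)
  }
  where open IndependentTrials T

successes-resampled : ∀ {Ω : Set} {σ : Summer Ω} {B h m} (T : IndependentTrials σ B h (suc m)) ω x →
  IndependentTrials.successes T (IndependentTrials.resample T fz ω x)
    ≡ 𝟙 (h x) + IndependentTrials.successes (tail T) ω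
successes-resampled {m = m} T ω x =
  cong₂ _+_ (cong 𝟙 (event-resampled fz ω x))
            (Linear.ext (∑-linear m) (λ i → cong 𝟙 (event-untouched fz (fs i) (λ ()) ω x)))
  where open IndependentTrials T

module _ {Ω : Set} {σ : Summer Ω} (σ-linear : Linear σ) {B : ℕ} {h : Fin B → Bool} where
  open Linear σ-linear
  open IndependentTrials

  private
    w : ℕ
    w = ∑ B (𝟙 ∘ h)

  ∑-𝟙-affine : ∀ A D → ∑ B (λ x → A + 𝟙 (h x) * D) ≡ B * A + w * D
  ∑-𝟙-affine A D = begin
    ∑ B (λ x → A + 𝟙 (h x) * D)                  ≡⟨ Linear.+-homo (∑-linear B) _ _ ⟩
    ∑ B (λ _ → A) + ∑ B (λ x → 𝟙 (h x) * D)      ≡⟨ cong₂ _+_ (∑-const B A) ∑-𝟙*D ⟩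
    B * A + w * D                                ∎
    where
    open ≡-Reasoning
    ∑-𝟙*D : ∑ B (λ x → 𝟙 (h x) * D) ≡ w * D
    ∑-𝟙*D = trans (Linear.ext (∑-linear B) (λ x → *-comm (𝟙 (h x)) D))
              (trans (Linear.*-homo (∑-linear B) D (𝟙 ∘ h)) (*-comm D w))

  moment-step : ∀ {m} (T : IndependentTrials σ B h (suc m)) r →
    B * σ (λ ω → successes T ω C suc r)
      ≡ B * σ (λ ω → successes (tail T) ω C suc r) + w * σ (λ ω → successes (tail T) ω C r)
  moment-step T r = begin
    B * σ (λ ω → successes T ω C suc r)
      ≡⟨ resamples T fz _ ⟩
    σ (λ ω → ∑ B (λ x → successes T (resample T fz ω x) C suc r))
      ≡⟨ ext (λ ω → Linear.ext (∑-linear B) (λ x →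
           trans (cong (_C suc r) (successes-resampled T ω x)) (C-𝟙+ (h x) (S ω) r))) ⟩
    σ (λ ω → ∑ B (λ x → S ω C suc r + 𝟙 (h x) * (S ω C r)))
      ≡⟨ ext (λ ω → ∑-𝟙-affine (S ω C suc r) (S ω C r)) ⟩
    σ (λ ω → B * (S ω C suc r) + w * (S ω C r))
      ≡⟨ trans (+-homo _ _) (cong₂ _+_ (*-homo B _) (*-homo w _)) ⟩
    B * σ (λ ω → S ω C suc r) + w * σ (λ ω → S ω C r)
      ∎
    where
    open ≡-Reasoning
    S : Ω → ℕ
    S = successes (tail T)

  binomial-moment : ∀ {m} (T : IndependentTrials σ B h m) r →
    B ^ r * σ (λ ω → successes T ω C r) ≡ (m C r) * w ^ r * σ (λ _ → 1)
  binomial-moment         T zero    = refl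
  binomial-moment {zero}  T (suc r) = trans (cong (B ^ suc r *_) 0-homo) (*-zeroʳ (B ^ suc r))
  binomial-moment {suc m} T (suc r) = begin
    B ^ suc r * σ (λ ω → successes T ω C suc r)
      ≡⟨ trans (*-assoc B (B ^ r) _) (x∙yz≈y∙xz B (B ^ r) _) ⟩
    B ^ r * (B * σ (λ ω → successes T ω C suc r))
      ≡⟨ cong (B ^ r *_) (moment-step T r) ⟩
    B ^ r * (B * σ (λ ω → S ω C suc r) + w * σ (λ ω → S ω C r))
      ≡⟨ regroup (B ^ r) B _ w _ ⟩
    B ^ suc r * σ (λ ω → S ω C suc r) + w * (B ^ r * σ (λ ω → S ω C r))
      ≡⟨ cong₂ (λ u v → u + w * v) (binomial-moment (tail T) (suc r)) (binomial-moment (tail T) r) ⟩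
    (m C suc r) * w ^ suc r * N + w * ((m C r) * w ^ r * N)
      ≡⟨ collect (m C suc r) (m C r) w (w ^ r) N ⟩
    (m C r + m C suc r) * w ^ suc r * N
      ≡⟨ cong (λ c → c * w ^ suc r * N) (nCk+nC[k+1]≡[n+1]C[k+1] m r) ⟩
    (suc m C suc r) * w ^ suc r * N
      ∎
    where
    open ≡-Reasoning
    S : Ω → ℕ
    S = successes (tail T)
    N : ℕ
    N = σ (λ _ → 1)
    regroup : ∀ Bʳ B P w Q → Bʳ * (B * P + w * Q) ≡ (B * Bʳ) * P + w * (Bʳ * Q)
    regroup = solve-∀
    collect : ∀ c₁ c₀ w wʳ N → c₁ * (w * wʳ) * N + w * (c₀ * wʳ * N) ≡ (c₀ + c₁) * (w * wʳ) * N
    collect = solve-∀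

module _ {Ω : Set} {σ : Summer Ω} (σ-linear : Linear σ) where
  open Linear σ-linear

  markov : ∀ (Z : Ω → ℕ) t → suc t * σ (λ ω → 𝟙 (not (Z ω ≤ᵇ t))) ≤ σ Z
  markov Z t = ≤-trans (≤-reflexive (sym (*-homo (suc t) _))) (mono pointwise)
    where
    pointwise : ∀ ω → suc t * 𝟙 (not (Z ω ≤ᵇ t)) ≤ Z ω
    pointwise ω with Z ω ≤ᵇ t in Z≤ᵇt
    ... | true  = ≤-trans (≤-reflexive (*-zeroʳ (suc t))) z≤n
    ... | false = ≤-trans (≤-reflexive (*-identityʳ (suc t)))
                          (≰⇒> λ Z≤t → subst T Z≤ᵇt (≤⇒≤ᵇ Z≤t))

  markov-5Z>2m : ∀ (Z : Ω → ℕ) m → 120 * σ Z ≤ m * σ (λ _ → 1) →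
                 100 * σ (λ ω → 𝟙 (not (5 * Z ω ≤ᵇ 2 * m))) ≤ 5 * σ (λ _ → 1)
  markov-5Z>2m Z m E[Z]≤ = begin
    100 * bad       ≤⟨ *-monoˡ-≤ bad (m≤m+n 100 20) ⟩
    120 * bad       ≡⟨ *-assoc 5 24 bad ⟩
    5 * (24 * bad)  ≤⟨ *-monoʳ-≤ 5 24bad≤N ⟩
    5 * N           ∎
    where
    open ≤-Reasoning
    N bad : ℕ
    N   = σ (λ _ → 1)
    bad = σ (λ ω → 𝟙 (not (5 * Z ω ≤ᵇ 2 * m)))
    24bad≤N : 24 * bad ≤ N
    24bad≤N = *-cancelˡ-≤ (suc (2 * m)) (begin
      suc (2 * m) * (24 * bad)  ≡⟨ x∙yz≈y∙xz (suc (2 * m)) 24 bad ⟩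
      24 * (suc (2 * m) * bad)  ≤⟨ *-monoʳ-≤ 24 (markov (λ ω → 5 * Z ω) (2 * m)) ⟩
      24 * σ (λ ω → 5 * Z ω)    ≡⟨ cong (24 *_) (*-homo 5 Z) ⟩
      24 * (5 * σ Z)            ≡⟨ *-assoc 24 5 (σ Z) ⟨
      120 * σ Z                 ≤⟨ E[Z]≤ ⟩
      m * N                     ≤⟨ *-monoˡ-≤ N (≤-trans (m≤m+n m _) (n≤1+n (2 * m))) ⟩
      suc (2 * m) * N           ∎)

  probAtLeast-by-complement : ∀ {E : Ω → Set} {num den} → num ≤ den → (G : Ω → Bool) →
    (∀ ω → T (G ω) → E ω) →
    den * σ (λ ω → 𝟙 (not (G ω))) ≤ (den ∸ num) * σ (λ _ → 1) →
    ProbAtLeast σ E num den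
  probAtLeast-by-complement {num = num} {den} num≤den G G⇒E rare = G , G⇒E ,
    +-cancelʳ-≤ (den * bad) (num * N) (den * good) (begin
      num * N + den * bad           ≤⟨ +-monoʳ-≤ (num * N) rare ⟩
      num * N + (den ∸ num) * N     ≡⟨ *-distribʳ-+ N num (den ∸ num) ⟨
      (num + (den ∸ num)) * N       ≡⟨ cong (_* N) (m+[n∸m]≡n num≤den) ⟩
      den * N                       ≡⟨ cong (den *_) good+bad ⟨
      den * (good + bad)            ≡⟨ *-distribˡ-+ den good bad ⟩
      den * good + den * bad        ∎)
    where
    open ≤-Reasoning
    N good bad : ℕ
    N    = σ (λ _ → 1)
    good = σ (λ ω → 𝟙 (G ω))
    bad  = σ (λ ω → 𝟙 (not (G ω)))
    good+bad : good + bad ≡ N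
    good+bad = trans (sym (+-homo _ _)) (ext λ ω → 𝟙+𝟙∘not (G ω))
      where 𝟙+𝟙∘not : ∀ b → 𝟙 b + 𝟙 (not b) ≡ 1
            𝟙+𝟙∘not true  = refl
            𝟙+𝟙∘not false = refl

n∸k≤nCk : ∀ n k → n ∸ suc k ≤ n C suc k
n∸k≤nCk zero    k       = z≤n
n∸k≤nCk (suc n) zero    = ≤-trans (n≤1+n n) (≤-reflexive (sym (nC1≡n (suc n))))
n∸k≤nCk (suc n) (suc k) = begin
  n ∸ suc k                    ≤⟨ n∸k≤nCk n k ⟩
  n C suc k                    ≤⟨ m≤m+n _ _ ⟩
  n C suc k + n C suc (suc k)  ≡⟨ nCk+nC[k+1]≡[n+1]C[k+1] n (suc k) ⟩
  suc n C suc (suc k)          ∎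
  where open ≤-Reasoning

n≤5+nC5 : ∀ n → n ≤ 5 + n C 5
n≤5+nC5 n = ≤-trans (m≤n+m∸n n 5) (+-monoʳ-≤ 5 (n∸k≤nCk n 4))

binomial-two-terms : ∀ n k → n ^ suc k + suc k * n ^ k ≤ suc n ^ suc k
binomial-two-terms n zero    = ≤-reflexive (base n)
  where base : ∀ n → n * 1 + 1 * 1 ≡ (1 + n) * 1
        base = solve-∀
binomial-two-terms n (suc k) = begin
  n ^ suc (suc k) + suc (suc k) * n ^ suc k
    ≤⟨ m≤m+n _ _ ⟩
  n ^ suc (suc k) + suc (suc k) * n ^ suc k + suc k * n ^ k
    ≡⟨ expand n k (n ^ k) ⟩
  suc n * (n ^ suc k + suc k * n ^ k)
    ≤⟨ *-monoʳ-≤ (suc n) (binomial-two-terms n k) ⟩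
  suc n ^ suc (suc k)
    ∎
  where
  open ≤-Reasoning
  expand : ∀ n k nᵏ → n * (n * nᵏ) + (2 + k) * (n * nᵏ) + (1 + k) * nᵏ
                    ≡ (1 + n) * (n * nᵏ + (1 + k) * nᵏ)
  expand = solve-∀

k!*nCk≤n^k : ∀ n k → k ! * (n C k) ≤ n ^ k
k!*nCk≤n^k zero    zero    = ≤-refl
k!*nCk≤n^k zero    (suc k) = ≤-reflexive (*-zeroʳ (suc k !))
k!*nCk≤n^k (suc n) zero    = ≤-refl
k!*nCk≤n^k (suc n) (suc k) = begin
  suc k ! * (suc n C suc k)
    ≡⟨ cong (suc k ! *_) (nCk+nC[k+1]≡[n+1]C[k+1] n k) ⟨
  suc k ! * (n C k + n C suc k)
    ≡⟨ distribute (suc k) (k !) (n C k) (n C suc k) ⟩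
  suc k ! * (n C suc k) + suc k * (k ! * (n C k))
    ≤⟨ +-mono-≤ (k!*nCk≤n^k n (suc k)) (*-monoʳ-≤ (suc k) (k!*nCk≤n^k n k)) ⟩
  n ^ suc k + suc k * n ^ k
    ≤⟨ binomial-two-terms n k ⟩
  suc n ^ suc k
    ∎
  where
  open ≤-Reasoning
  distribute : ∀ k₁ k! c₀ c₁ → (k₁ * k!) * (c₀ + c₁) ≡ (k₁ * k!) * c₁ + k₁ * (k! * c₀)
  distribute = solve-∀

-- Bob's input: collisions force even spreading

load : ∀ {L K} → BobInput L K → Fin K → Fin L → ℕ
load {L} y k l = ∑ L (λ i → y i k l)

-- The number of 5-sets of Bob's queries that meet in a common coordinate.
collisions : ∀ {L K} → BobInput L K → ℕ
collisions {L} {K} y = (∑ K ⊗ ∑ L) (λ (k , l) → load y k l C 5)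

∑-if : ∀ n b (f : Fin n → ℕ) → ∑ n (λ i → if b then f i else 0) ≡ (if b then ∑ n f else 0)
∑-if n true  f = refl
∑-if n false f = Linear.0-homo (∑-linear n)

onesIn≡ : ∀ L K y S → onesIn L K y S ≡ (∑ K ⊗ ∑ L) (λ (k , l) → if S k l then load y k l else 0)
onesIn≡ L K y S =
  trans (∑-swap L (∑-linear K) _)
        (Linear.ext (∑-linear K) (λ k →
          trans (∑-swap L (∑-linear L) _)
                (Linear.ext (∑-linear L) (λ l → ∑-if L (S k l) (λ i → y i k l)))))

onesIn≤ : ∀ L K y S → onesIn L K y S ≤ 5 * size L K S + collisions y
onesIn≤ L K y S = begin
  onesIn L K y S
    ≡⟨ onesIn≡ L K y S ⟩
  σ (λ (k , l) → if S k l then load y k l else 0)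
    ≤⟨ mono (λ (k , l) → pointwise (S k l) (load y k l)) ⟩
  σ (λ (k , l) → 5 * 𝟙 (S k l) + load y k l C 5)
    ≡⟨ trans (+-homo _ _) (cong (_+ collisions y) (*-homo 5 _)) ⟩
  5 * size L K S + collisions y
    ∎
  where
  open ≤-Reasoning
  σ : Summer (Fin K × Fin L)
  σ = ∑ K ⊗ ∑ L
  open Linear (⊗-linear (∑-linear K) (∑-linear L))
  pointwise : ∀ b n → (if b then n else 0) ≤ 5 * 𝟙 b + n C 5
  pointwise true  n = n≤5+nC5 n
  pointwise false n = z≤n

few-collisions⇒evenlySpreading : ∀ L K (y : BobInput L K) →
  5 * collisions y ≤ 2 * (L * K) → EvenlySpreading L K y
few-collisions⇒evenlySpreading L K y few S small = begin
  10 * onesIn L K y S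
    ≤⟨ *-monoʳ-≤ 10 (onesIn≤ L K y S) ⟩
  10 * (5 * size L K S + collisions y)
    ≡⟨ regroup (size L K S) (collisions y) ⟩
  5 * (10 * size L K S) + 2 * (5 * collisions y)
    ≤⟨ +-mono-≤ (*-monoʳ-≤ 5 small) (*-monoʳ-≤ 2 few) ⟩
  5 * (L * K) + 2 * (2 * (L * K))
    ≡⟨ collect (L * K) ⟩
  9 * (L * K)
    ∎
  where
  open ≤-Reasoning
  regroup : ∀ s z → 10 * (5 * s + z) ≡ 5 * (10 * s) + 2 * (5 * z)
  regroup = solve-∀
  collect : ∀ m → 5 * m + 2 * (2 * m) ≡ 9 * m
  collect = solve-∀

-- Bit reversal and the level sets of countE

revBits< : ∀ n x → revBits n x < 2 ^ n
revBits< zero    x = s≤s z≤n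
revBits< (suc n) x = begin-strict
  (x % 2) * 2 ^ n + revBits n (x / 2)  <⟨ +-monoʳ-< _ (revBits< n (x / 2)) ⟩
  (x % 2) * 2 ^ n + 2 ^ n              ≤⟨ +-monoˡ-≤ (2 ^ n) (*-monoˡ-≤ (2 ^ n) (≤-pred (m%n<n x 2))) ⟩
  1 * 2 ^ n + 2 ^ n                    ≡⟨ +-comm (1 * 2 ^ n) (2 ^ n) ⟩
  2 * 2 ^ n                            ∎
  where open ≤-Reasoning

revBits-++ : ∀ n m x y → x < 2 ^ n →
             revBits (n + m) (x + 2 ^ n * y) ≡ revBits n x * 2 ^ m + revBits m y
revBits-++ zero    m zero    y _ = cong (revBits m) (+-identityʳ y)
revBits-++ zero    m (suc x) y (s≤s ())
revBits-++ (suc n) m x       y x<2ⁿ⁺¹ = begin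
  (t % 2) * 2 ^ (n + m) + revBits (n + m) (t / 2)
    ≡⟨ cong₂ (λ u v → u * 2 ^ (n + m) + revBits (n + m) v) t%2 t/2 ⟩
  (x % 2) * 2 ^ (n + m) + revBits (n + m) (x / 2 + 2 ^ n * y)
    ≡⟨ cong₂ _+_ (cong ((x % 2) *_) (^-distribˡ-+-* 2 n m))
                 (revBits-++ n m (x / 2) y (m<n*o⇒m/o<n (subst (x <_) (*-comm 2 (2 ^ n)) x<2ⁿ⁺¹))) ⟩
  (x % 2) * (2 ^ n * 2 ^ m) + (revBits n (x / 2) * 2 ^ m + revBits m y)
    ≡⟨ regroup (x % 2) (2 ^ n) (2 ^ m) (revBits n (x / 2)) (revBits m y) ⟩
  ((x % 2) * 2 ^ n + revBits n (x / 2)) * 2 ^ m + revBits m y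
    ∎
  where
  open ≡-Reasoning
  t : ℕ
  t = x + 2 ^ suc n * y
  t≡x+_*2 : t ≡ x + (2 ^ n * y) * 2
  t≡x+_*2 = cong (x +_) (trans (*-assoc 2 (2 ^ n) y) (*-comm 2 (2 ^ n * y)))
  t%2 : t % 2 ≡ x % 2
  t%2 = trans (cong (_% 2) t≡x+_*2) ([m+kn]%n≡m%n x (2 ^ n * y) 2)
  t/2 : t / 2 ≡ x / 2 + 2 ^ n * y
  t/2 = trans (cong (_/ 2) t≡x+_*2)
        (trans (+-distrib-/-∣ʳ x (divides (2 ^ n * y) refl)) (cong (x / 2 +_) (m*n/n≡m (2 ^ n * y) 2)))
  regroup : ∀ b P M r q → b * (P * M) + (r * M + q) ≡ (b * P + r) * M + q
  regroup = solve-∀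

revBits-involutive : ∀ n x → x < 2 ^ n → revBits n (revBits n x) ≡ x
revBits-involutive zero    zero    _ = refl
revBits-involutive zero    (suc x) (s≤s ())
revBits-involutive (suc n) x x<2ⁿ⁺¹ = begin
  revBits (suc n) ((x % 2) * 2 ^ n + revBits n (x / 2))
    ≡⟨ cong₂ revBits (+-comm 1 n) (trans (+-comm ((x % 2) * 2 ^ n) _) (cong (revBits n (x / 2) +_) (*-comm (x % 2) (2 ^ n)))) ⟩
  revBits (n + 1) (revBits n (x / 2) + 2 ^ n * (x % 2))
    ≡⟨ revBits-++ n 1 (revBits n (x / 2)) (x % 2) (revBits< n (x / 2)) ⟩
  revBits n (revBits n (x / 2)) * 2 + revBits 1 (x % 2)
    ≡⟨ cong₂ (λ u v → u * 2 + v) (revBits-involutive n (x / 2) x/2<2ⁿ) revBits1 ⟩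
  (x / 2) * 2 + x % 2
    ≡⟨ trans (+-comm _ (x % 2)) (sym (m≡m%n+[m/n]*n x 2)) ⟩
  x
    ∎
  where
  open ≡-Reasoning
  x/2<2ⁿ : x / 2 < 2 ^ n
  x/2<2ⁿ = m<n*o⇒m/o<n (subst (x <_) (*-comm 2 (2 ^ n)) x<2ⁿ⁺¹)
  revBits1 : revBits 1 (x % 2) ≡ x % 2
  revBits1 = trans (+-identityʳ _) (trans (*-identityʳ _) (m%n%n≡m%n x 2))

module _ {A : Set} {P Q : A → Set} (P? : Decidable P) (Q? : Decidable Q) (P⇒Q : ∀ {x} → P x → Q x) where

  length-filter-mono : ∀ xs → length (filter P? xs) ≤ length (filter Q? xs)
  length-filter-mono List.[]  = z≤n
  length-filter-mono (x List.∷ xs) with P? x | Q? x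
  ... | yes p | yes _  = s≤s (length-filter-mono xs)
  ... | yes p | no ¬q  = contradiction (P⇒Q p) ¬q
  ... | no _  | yes _  = m≤n⇒m≤1+n (length-filter-mono xs)
  ... | no _  | no _   = length-filter-mono xs

  length-filter-< : ∀ {xs} → Any (λ x → Q x × ¬ P x) xs → length (filter P? xs) < length (filter Q? xs)
  length-filter-< {x List.∷ xs} (here (q , ¬p)) with P? x | Q? x
  ... | yes p | _      = contradiction p ¬p
  ... | no _  | yes _  = s≤s (length-filter-mono xs)
  ... | no _  | no ¬q  = contradiction q ¬q
  length-filter-< {x List.∷ xs} (there any) with P? x | Q? x
  ... | yes _ | yes _  = s≤s (length-filter-< any)
  ... | yes p | no ¬q  = contradiction (P⇒Q p) ¬q
  ... | no _  | yes _  = m≤n⇒m≤1+n (length-filter-< any)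
  ... | no _  | no _   = length-filter-< any

-- The entries of sequence k updated in I_A sit at the positions q · W + rev(s), q < L,
-- where W = 2 ^ (|s| + 1): one in every window of W consecutive positions. So countE
-- increases from window to window, and each of its level sets has at most W elements.
module _ (a c : ℕ) (s : Fin (2 ^ a)) where
  private
    W L ρ : ℕ
    W = 2 ^ a * 2
    L = 2 ^ c
    ρ = revBits a (toℕ s)

    position : ℕ → ℕ
    position r = revBits (a + suc c) ((toℕ s * 2) * 2 ^ c + r)

    cE : ℕ → ℕ
    cE = countE a c s

  position-rev : ∀ q → q < L → position (revBits c q) ≡ q * W + ρ
  position-rev q q<L = begin
    revBits (a + suc c) ((toℕ s * 2) * 2 ^ c + revBits c q)
      ≡⟨ cong₂ revBits (trans (+-suc a c) (+-comm (suc a) c))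
                       (trans (+-comm _ (revBits c q)) (cong (revBits c q +_) (*-comm _ (2 ^ c)))) ⟩
    revBits (c + suc a) (revBits c q + 2 ^ c * (toℕ s * 2))
      ≡⟨ revBits-++ c (suc a) (revBits c q) (toℕ s * 2) (revBits< c q) ⟩
    revBits c (revBits c q) * 2 ^ suc a + revBits (suc a) (toℕ s * 2)
      ≡⟨ cong₂ (λ r W → r * W + revBits (suc a) (toℕ s * 2)) (revBits-involutive c q q<L) (*-comm 2 (2 ^ a)) ⟩
    q * W + revBits (suc a) (toℕ s * 2)
      ≡⟨ cong₂ (λ b t → q * W + (b * 2 ^ a + revBits a t)) (m*n%n≡0 (toℕ s) 2) (m*n/n≡m (toℕ s) 2) ⟩
    q * W + ρ
      ∎
    where open ≡-Reasoning

  countE-mono : ∀ {j j′} → j ≤ j′ → cE j ≤ cE j′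
  countE-mono j≤j′ = length-filter-mono (λ r → position r ≤? _) (λ r → position r ≤? _)
                       (λ p≤j → ≤-trans p≤j j≤j′) (upTo L)

  countE-jump : ∀ {j j′} q → q < L → j < q * W + ρ → q * W + ρ ≤ j′ → cE j < cE j′
  countE-jump {j} {j′} q q<L j<p p≤j′ =
    length-filter-< (λ r → position r ≤? j) (λ r → position r ≤? j′)
      (λ p≤j → ≤-trans p≤j (≤-trans (<⇒≤ j<p) p≤j′))
      (lose (∈-upTo⁺ (revBits< c q))
            (subst (_≤ j′) (sym (position-rev q q<L)) p≤j′ ,
             λ p≤j → <⇒≱ j<p (subst (_≤ j) (position-rev q q<L) p≤j)))

  private
    within-window : ∀ q {v} → v < W → q * W + v < suc q * W
    within-window q {v} v<W = subst (q * W + v <_) (+-comm (q * W) W) (+-monoʳ-< (q * W) v<W)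

    ρ<W : ρ < W
    ρ<W = <-≤-trans (revBits< a (toℕ s)) (m≤m*n (2 ^ a) 2)

  countE-step : ∀ q u → suc q < L → u < W → cE (q * W + u) < cE (suc q * W + u)
  countE-step q u 1+q<L u<W with ρ ≤? u
  ... | yes ρ≤u = countE-jump (suc q) 1+q<L
                    (<-≤-trans (within-window q u<W) (m≤m+n _ ρ)) (+-monoʳ-≤ (suc q * W) ρ≤u)
  ... | no ρ≰u  = countE-jump q (<-trans (n<1+n q) 1+q<L)
                    (+-monoʳ-< (q * W) (≰⇒> ρ≰u)) (≤-trans (<⇒≤ (within-window q ρ<W)) (m≤m+n _ u))

  countE-< : ∀ {q q′ u} → q < q′ → q′ < L → u < W → cE (q * W + u) < cE (q′ * W + u)
  countE-< {q} {q′} {u} q<q′ q′<L u<W =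
    <-≤-trans (countE-step q u (≤-<-trans q<q′ q′<L) u<W) (countE-mono (+-monoˡ-≤ u (*-monoˡ-≤ W q<q′)))

  countE-injective : ∀ {q q′ u} → q < L → q′ < L → u < W →
                     cE (q * W + u) ≡ cE (q′ * W + u) → q ≡ q′
  countE-injective {q} {q′} q<L q′<L u<W eq with <-cmp q q′
  ... | tri< q<q′ _ _ = contradiction eq (<⇒≢ (countE-< q<q′ q′<L u<W))
  ... | tri≈ _ q≡q′ _ = q≡q′
  ... | tri> _ _ q′<q = contradiction (sym eq) (<⇒≢ (countE-< q′<q q<L u<W))

  countE-level≤ : ∀ v → ∑ (Bsz a c) (λ x → 𝟙 (v ≡ᵇ cE (toℕ x))) ≤ W
  countE-level≤ v = begin
    ∑ (W * L) (hit ∘ toℕ)                            ≡⟨ cong (λ n → ∑ n (hit ∘ toℕ)) (*-comm W L) ⟩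
    ∑ (L * W) (hit ∘ toℕ)                            ≡⟨ ∑-toℕ-* L W hit ⟩
    ∑ L (λ q → ∑ W (λ u → hit (toℕ q * W + toℕ u)))  ≡⟨ ∑-swap L (∑-linear W) _ ⟩
    ∑ W (λ u → ∑ L (λ q → hit (toℕ q * W + toℕ u)))  ≤⟨ Linear.mono (∑-linear W) at-most-one ⟩
    ∑ W (λ _ → 1)                                    ≡⟨ ∑-1 W ⟩
    W                                                ∎
    where
    open ≤-Reasoning
    hit : ℕ → ℕ
    hit j = 𝟙 (v ≡ᵇ cE j)
    at-most-one : ∀ u → ∑ L (λ q → hit (toℕ q * W + toℕ u)) ≤ 1
    at-most-one u = ∑-𝟙-unique L _ λ q q′ hit-q hit-q′ →
      toℕ-injective (countE-injective (toℕ<n q) (toℕ<n q′) (toℕ<n u)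
                       (trans (sym (≡ᵇ⇒≡ v (cE (toℕ q * W + toℕ u)) hit-q))
                              (≡ᵇ⇒≡ v (cE (toℕ q′ * W + toℕ u)) hit-q′)))

combine-injectiveʳ : ∀ {m n} (i : Fin m) {j j′ : Fin n} → combine i j ≡ combine i j′ → j ≡ j′
combine-injectiveʳ {n = n} i {j} {j′} eq =
  cong proj₂ (trans (sym (remQuot-combine i j)) (trans (cong (remQuot n) eq) (remQuot-combine i j′)))

sample-linear : ∀ a c K p → Linear (sumSample a c K p)
sample-linear a c K p = ⊗-linear (sumFun-linear _ (sumFun-linear K (∑-linear p)))
                                 (sumFun-linear _ (sumFun-linear K (∑-linear (Bsz a c))))

sample-resamples : ∀ a c K p (t : Fin (Bsz a c)) (k : Fin K) →
  Resamples (Bsz a c) (sumSample a c K p) (λ ω x → proj₁ ω , proj₂ ω [ t ]≔ (proj₂ ω t [ k ]≔ x))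
sample-resamples a c K p t k =
  ⊗-resamples {τ = sumFun B (sumFun K (∑ B))} {B = B} (sumFun-linear B (sumFun-linear K (∑-linear p)))
    (sumFun-resamples {R = λ g x → g [ k ]≔ x} (sumFun-linear K (∑-linear B))
      (sumFun-resamples {R = λ _ x → x} (∑-linear B) (∑-resamples B) K k) B t)
  where
  B : ℕ
  B = Bsz a c

-- Event i: y_i has the 1 of block k in coordinate l, i.e. the k-th index of the i-th query
-- of I_B lies in level l + 1 of countE.
query-trials : ∀ a c K p (s : Fin (2 ^ a)) (k : Fin K) (l : Fin (2 ^ c)) →
  IndependentTrials (sumSample a c K p) (Bsz a c) (λ x → suc (toℕ l) ≡ᵇ countE a c s (toℕ x)) (2 ^ c)
query-trials a c K p s k l = record
  { event           = λ i ω → hit (proj₂ ω (t i) k)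
  ; resample        = λ i ω x → proj₁ ω , proj₂ ω [ t i ]≔ (proj₂ ω (t i) [ k ]≔ x)
  ; resamples       = λ i → sample-resamples a c K p (t i) k
  ; event-resampled = λ i ω x → cong hit
      (trans (cong (λ q → q k) ([]≔-updates (proj₂ ω) (t i) _)) ([]≔-updates (proj₂ ω (t i)) k x))
  ; event-untouched = λ i j j≢i ω x → cong (λ q → hit (q k))
      ([]≔-minimal (proj₂ ω) (t i) _ (j≢i ∘ combine-injectiveʳ (combine s (fs fz))))
  }
  where
  hit : Fin (Bsz a c) → Bool
  hit x = suc (toℕ l) ≡ᵇ countE a c s (toℕ x)
  t : Fin (2 ^ c) → Fin (Bsz a c)
  t = time a c s (fs fz)

module _ (a c K p : ℕ) (s : Fin (2 ^ a)) where
  private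
    B L W N : ℕ
    B = Bsz a c
    L = 2 ^ c
    W = 2 ^ a * 2
    σ : Summer (Sample a c K p)
    σ = sumSample a c K p
    N = σ (λ _ → 1)
    y : Sample a c K p → BobInput L K
    y = bobInput a c K p s
    level : Fin L → ℕ
    level l = ∑ B (λ x → 𝟙 (suc (toℕ l) ≡ᵇ countE a c s (toℕ x)))

  coordinate-moment : ∀ k l → 120 * (B ^ 5 * σ (λ ω → load (y ω) k l C 5)) ≤ L ^ 5 * W ^ 4 * N * level l
  coordinate-moment k l = begin
    120 * (B ^ 5 * σ (λ ω → load (y ω) k l C 5))
      ≡⟨ cong (120 *_) (binomial-moment (sample-linear a c K p) (query-trials a c K p s k l) 5) ⟩
    120 * ((L C 5) * level l ^ 5 * N)
      ≡⟨ regroup 120 (L C 5) (level l) (level l ^ 4) N ⟩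
    (120 * (L C 5)) * (level l ^ 4 * level l) * N
      ≤⟨ *-monoˡ-≤ N (*-mono-≤ (k!*nCk≤n^k L 5)
                               (*-monoˡ-≤ (level l) (^-monoˡ-≤ 4 (countE-level≤ a c s (suc (toℕ l)))))) ⟩
    L ^ 5 * (W ^ 4 * level l) * N
      ≡⟨ regroup′ (L ^ 5) (W ^ 4) (level l) N ⟩
    L ^ 5 * W ^ 4 * N * level l
      ∎
    where
    open ≤-Reasoning
    regroup : ∀ f c w w⁴ N → f * (c * (w * w⁴) * N) ≡ (f * c) * (w⁴ * w) * N
    regroup = solve-∀
    regroup′ : ∀ x y w N → x * (y * w) * N ≡ x * y * N * w
    regroup′ = solve-∀

  expected-collisions : 120 * σ (λ ω → collisions (y ω)) ≤ L * K * N
  expected-collisions = *-cancelˡ-≤ (B ^ 5) {{B⁵≢0}} (begin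
    B ^ 5 * (120 * σ (λ ω → collisions (y ω)))
      ≡⟨ x∙yz≈y∙xz (B ^ 5) 120 _ ⟩
    120 * (B ^ 5 * σ (λ ω → collisions (y ω)))
      ≡⟨ cong (λ z → 120 * (B ^ 5 * z)) (∑⊗∑-swap K L (sample-linear a c K p) _) ⟨
    120 * (B ^ 5 * ∑ₖₗ (λ (k , l) → σ (λ ω → load (y ω) k l C 5)))
      ≡⟨ trans (*-homo 120 _) (cong (120 *_) (*-homo (B ^ 5) _)) ⟨
    ∑ₖₗ (λ (k , l) → 120 * (B ^ 5 * σ (λ ω → load (y ω) k l C 5)))
      ≤⟨ mono (λ (k , l) → coordinate-moment k l) ⟩
    ∑ₖₗ (λ (k , l) → M * level l)
      ≡⟨ trans (Linear.ext (∑-linear K) (λ _ → Linear.*-homo (∑-linear L) M level)) (∑-const K _) ⟩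
    K * (M * ∑ L level)
      ≤⟨ *-monoʳ-≤ K (*-monoʳ-≤ M (∑-level-sets≤ L B (countE a c s ∘ toℕ))) ⟩
    K * (M * B)
      ≡⟨ regroup W L K N ⟩
    B ^ 5 * (L * K * N)
      ∎)
    where
    open ≤-Reasoning
    ∑ₖₗ : Summer (Fin K × Fin L)
    ∑ₖₗ = ∑ K ⊗ ∑ L
    open Linear (⊗-linear (∑-linear K) (∑-linear L))
    M : ℕ
    M = L ^ 5 * W ^ 4 * N
    B⁵≢0 : NonZero (B ^ 5)
    B⁵≢0 = m^n≢0 B 5 {{m*n≢0 W L {{m*n≢0 (2 ^ a) 2 {{m^n≢0 2 a}}}} {{m^n≢0 2 c}}}}
    -- the powers are spelled out because the ring solver does not normalise _^_
    regroup : ∀ W L K N →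
      K * (L * (L * (L * (L * (L * 1)))) * (W * (W * (W * (W * 1)))) * N * (W * L))
        ≡ (W * L) * ((W * L) * ((W * L) * ((W * L) * ((W * L) * 1)))) * (L * K * N)
    regroup = solve-∀

-- The bound holds for all L and K, so the threshold on L · K is 0.
lemma4 : Σ ℕ λ N → (a c K p : ℕ) → Prime p → (s : Fin (2 ^ a)) →
    N ≤ 2 ^ c * K →
    ProbAtLeast (sumSample a c K p)
    (λ ω → EvenlySpreading (2 ^ c) K (bobInput a c K p s ω)) 95 100
lemma4 = 0 , λ a c K p _ s _ →
  let y = bobInput a c K p s
      m = 2 ^ c * K
  in probAtLeast-by-complement (sample-linear a c K p) (m≤m+n 95 5)
       (λ ω → 5 * collisions (y ω) ≤ᵇ 2 * m)
       (λ ω few → few-collisions⇒evenlySpreading (2 ^ c) K (y ω) (≤ᵇ⇒≤ _ _ few))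
       (markov-5Z>2m (sample-linear a c K p) (collisions ∘ y) m (expected-collisions a c K p s))
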